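{- For every positive integer $n$ that is a perfect square, there exists a set $\mathcal P$ of $n$ points in $\mathbb R^2$ such that no two points of $\mathcal P$ have the same $x$-coordinate and $D(\mathcal P)=2\sqrt{n}-2$ under the $\ell_\infty$ metric.
   Context: Under the $\ell_\infty$ metric, the distance between $(a_x,a_y)$ and $(b_x,b_y)$ is $\max\{|a_x-b_x|,|a_y-b_y|\}$. For a finite set $\mathcal P\subset\mathbb R^2$, $D(\mathcal P)$ denotes the number of distinct distances spanned by pairs of distinct points of $\mathcal P$. -}

module Defs where

open import Data.Nat using (ℕ)
open import Data.Fin using (Fin)
open import Data.Rational using (ℚ; _-_; _⊔_; ∣_∣)
open import Data.Product using (_×_; _,_; proj₁; proj₂; ∃; ∃-syntax; Σ-syntax)
open import Data.List using (List; length)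
open import Data.List.Membership.Propositional using (_∈_)
open import Data.List.Relation.Unary.Unique.Propositional using (Unique)
open import Relation.Binary.PropositionalEquality using (_≡_; _≢_)
open import Function.Bundles using (_⇔_)

Point : Set
Point = ℚ × ℚ

xcoord : Point → ℚ
xcoord = proj₁

ycoord : Point → ℚ
ycoord = proj₂

dist∞ : Point → Point → ℚ
dist∞ (ax , ay) (bx , by) = ∣ ax - bx ∣ ⊔ ∣ ay - by ∣

-- d is a distance spanned by a pair of distinct points of P
-- (P is indexed by Fin n; points are distinct by injectivity hypotheses)
IsDistance : {n : ℕ} → (Fin n → Point) → ℚ → Set
IsDistance {n} P d = ∃[ i ] ∃[ j ] (i ≢ j × dist∞ (P i) (P j) ≡ d)

-- D(P) = m : the set of spanned distances has exactly m elements,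
-- i.e. it is enumerated by a duplicate-free list of length m.
NumDistances : {n : ℕ} → (Fin n → Point) → ℕ → Set
NumDistances P m =
  ∃[ Ds ] (Unique Ds × length Ds ≡ m × (∀ d → (d ∈ Ds) ⇔ IsDistance P d))

DistinctX : {n : ℕ} → (Fin n → Point) → Set
DistinctX {n} P = (i j : Fin n) → i ≢ j → xcoord (P i) ≢ xcoord (P j)

{-# OPTIONS --safe #-}
module Submission where

-- Take the k² points (x , k² (x mod k)) for x < k²; their x-coordinates are distinct.
-- Write x = q k + r with q, r < k.  Two points with the same residue r are at
-- ℓ∞-distance |x − x'| = k |q − q'|, while for r ≠ r' the vertical gap k² |r − r'| ≥ k²
-- exceeds the horizontal gap |x − x'| < k².  So the distances are exactly
-- k, 2k, …, (k−1)k and k², 2k², …, (k−1)k², which are 2k − 2 distinct values.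

open import Defs
open import Data.Nat
  using (ℕ; zero; suc; NonZero; ≢-nonZero; _+_; _*_; _∸_; _⊔_; ∣_-_∣; _≤_; _<_; _≟_; z≤n; s≤s; s≤s⁻¹)
open import Data.Nat.Properties
open import Data.Nat.DivMod
  using (_%_; _/_; m≡m%n+[m/n]*n; m%n<n; m<n*o⇒m/o<n; m*n%n≡0; m*n/n≡m; m<n⇒m%n≡m)
open import Data.Integer as ℤ using (+_; _⊖_)
import Data.Integer.Properties as ℤ
open import Data.Rational as ℚ using (ℚ)
open import Data.Rational.Literals using (fromℤ)
import Data.Rational.Properties as ℚ
import Data.Rational.Unnormalised as ℚᵘ
import Data.Rational.Unnormalised.Properties as ℚᵘ
open import Data.Fin using (Fin; zero; toℕ; fromℕ<)
open import Data.Fin.Properties using (toℕ-injective; toℕ<n; toℕ-fromℕ<)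
open import Data.Product using (Σ-syntax; _×_; _,_; ∃-syntax)
open import Data.Sum using (inj₁; inj₂)
open import Data.List using (List; _++_; applyUpTo; length; map)
open import Data.List.Properties using (length-map; length-++; length-applyUpTo)
open import Data.List.Membership.Propositional using (_∈_)
open import Data.List.Membership.Propositional.Properties
  using (∈-map⁺; ∈-map⁻; ∈-++⁺ˡ; ∈-++⁺ʳ; ∈-++⁻; ∈-applyUpTo⁺; ∈-applyUpTo⁻)
open import Data.List.Relation.Unary.Unique.Propositional using (Unique)
import Data.List.Relation.Unary.Unique.Propositional.Properties as Unique
open import Data.Empty using (⊥-elim)
open import Function using (_∘_)
open import Function.Bundles using (_⇔_; mk⇔; Equivalence)
open import Relation.Nullary using (yes; no)
open import Relation.Binary.PropositionalEquality

∣m⊖n∣≡∣m-n∣ : ∀ m n → ℤ.∣ m ⊖ n ∣ ≡ ∣ m - n ∣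
∣m⊖n∣≡∣m-n∣ zero    zero    = refl
∣m⊖n∣≡∣m-n∣ zero    (suc n) = refl
∣m⊖n∣≡∣m-n∣ (suc m) zero    = refl
∣m⊖n∣≡∣m-n∣ (suc m) (suc n) =
  trans (cong ℤ.∣_∣ (ℤ.[1+m]⊖[1+n]≡m⊖n m n)) (∣m⊖n∣≡∣m-n∣ m n)

ι : ℕ → ℚ
ι n = fromℤ (+ n)

ι-injective : ∀ {a b} → ι a ≡ ι b → a ≡ b
ι-injective refl = refl

ι-mono-≤ : ∀ {a b} → a ≤ b → ι a ℚ.≤ ι b
ι-mono-≤ {a} {b} a≤b =
  ℚ.*≤* (subst₂ ℤ._≤_ (sym (ℤ.*-identityʳ (+ a))) (sym (ℤ.*-identityʳ (+ b))) (ℤ.+≤+ a≤b))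

ι-⊔ : ∀ a b → ι (a ⊔ b) ≡ ι a ℚ.⊔ ι b
ι-⊔ a b with ≤-total a b
... | inj₁ a≤b = trans (cong ι (m≤n⇒m⊔n≡n a≤b)) (sym (ℚ.p≤q⇒p⊔q≡q (ι-mono-≤ a≤b)))
... | inj₂ b≤a = trans (cong ι (m≥n⇒m⊔n≡m b≤a)) (sym (ℚ.p≥q⇒p⊔q≡p (ι-mono-≤ b≤a)))

ι-minus : ∀ a b → ι a ℚ.- ι b ≡ fromℤ (a ⊖ b)
ι-minus a b = ℚ.toℚᵘ-injective (begin
    ℚ.toℚᵘ (ι a ℚ.- ι b)                 ≈⟨ ℚ.toℚᵘ-homo-+ (ι a) (ℚ.- ι b) ⟩
    ℚ.toℚᵘ (ι a) ℚᵘ.+ ℚ.toℚᵘ (ℚ.- ι b)  ≈⟨ ℚᵘ.+-congʳ (ℚ.toℚᵘ (ι a)) (ℚ.toℚᵘ-homo‿- (ι b)) ⟩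
    ℚ.toℚᵘ (ι a) ℚᵘ.- ℚ.toℚᵘ (ι b)      ≈⟨ ℚᵘ.*≡* (cong (ℤ._* + 1) numerator) ⟩
    ℚ.toℚᵘ (fromℤ (a ⊖ b))              ∎)
  where
    open ℚᵘ.≃-Reasoning
    numerator : + a ℤ.* + 1 ℤ.+ ℤ.- + b ℤ.* + 1 ≡ a ⊖ b
    numerator = trans (cong₂ ℤ._+_ (ℤ.*-identityʳ (+ a)) (ℤ.*-identityʳ (ℤ.- + b)))
                      (ℤ.[+m]-[+n]≡m⊖n a b)

ι-∣-∣ : ∀ a b → ℚ.∣ ι a ℚ.- ι b ∣ ≡ ι ∣ a - b ∣
ι-∣-∣ a b = begin
  ℚ.∣ ι a ℚ.- ι b ∣        ≡⟨ cong ℚ.∣_∣ (ι-minus a b) ⟩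
  ℚ.∣ fromℤ (a ⊖ b) ∣      ≡⟨⟩
  fromℤ (+ ℤ.∣ a ⊖ b ∣)    ≡⟨ cong ι (∣m⊖n∣≡∣m-n∣ a b) ⟩
  ι ∣ a - b ∣              ∎
  where open ≡-Reasoning

embed : ℕ × ℕ → Point
embed (x , y) = ι x , ι y

ℓ∞ : ℕ × ℕ → ℕ × ℕ → ℕ
ℓ∞ (x , y) (x' , y') = ∣ x - x' ∣ ⊔ ∣ y - y' ∣

dist∞-embed : ∀ p p' → dist∞ (embed p) (embed p') ≡ ι (ℓ∞ p p')
dist∞-embed (x , y) (x' , y') = begin
  ℚ.∣ ι x ℚ.- ι x' ∣ ℚ.⊔ ℚ.∣ ι y ℚ.- ι y' ∣  ≡⟨ cong₂ ℚ._⊔_ (ι-∣-∣ x x') (ι-∣-∣ y y') ⟩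
  ι ∣ x - x' ∣ ℚ.⊔ ι ∣ y - y' ∣              ≡⟨ ι-⊔ ∣ x - x' ∣ ∣ y - y' ∣ ⟨
  ι (ℓ∞ (x , y) (x' , y'))                   ∎
  where open ≡-Reasoning

SpansDistance : {n : ℕ} → (Fin n → ℕ × ℕ) → ℕ → Set
SpansDistance P d = ∃[ i ] ∃[ j ] (i ≢ j × ℓ∞ (P i) (P j) ≡ d)

numDistances-embed : {n : ℕ} (P : Fin n → ℕ × ℕ) (Ds : List ℕ) → Unique Ds →
                     (∀ d → d ∈ Ds ⇔ SpansDistance P d) → NumDistances (embed ∘ P) (length Ds)
numDistances-embed P Ds Ds-unique Ds-spanned =
  map ι Ds , Unique.map⁺ ι-injective Ds-unique , length-map ι Ds ,
  λ d → mk⇔ (spanned d) (listed d)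
  where
    spanned : ∀ d → d ∈ map ι Ds → IsDistance (embed ∘ P) d
    spanned d d∈ with ∈-map⁻ ι d∈
    ... | e , e∈Ds , refl with Equivalence.to (Ds-spanned e) e∈Ds
    ...   | i , j , i≢j , dist≡e = i , j , i≢j , trans (dist∞-embed (P i) (P j)) (cong ι dist≡e)

    listed : ∀ d → IsDistance (embed ∘ P) d → d ∈ map ι Ds
    listed d (i , j , i≢j , refl) = subst (_∈ map ι Ds) (sym (dist∞-embed (P i) (P j)))
      (∈-map⁺ ι (Equivalence.from (Ds-spanned _) (i , j , i≢j , refl)))

%-/-injective : ∀ {x y n} .{{_ : NonZero n}} → x % n ≡ y % n → x / n ≡ y / n → x ≡ y
%-/-injective {x} {y} {n} r≡ q≡ = begin
  x                  ≡⟨ m≡m%n+[m/n]*n x n ⟩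
  x % n + x / n * n  ≡⟨ cong₂ (λ r q → r + q * n) r≡ q≡ ⟩
  y % n + y / n * n  ≡⟨ m≡m%n+[m/n]*n y n ⟨
  y                  ∎
  where open ≡-Reasoning

multiples : ℕ → ℕ → List ℕ
multiples m l = applyUpTo (λ t → suc t * m) l

multiples-unique : ∀ m l .{{_ : NonZero m}} → Unique (multiples m l)
multiples-unique m l = Unique.applyUpTo⁺₁ _ l
  (λ s<t _ eq → <⇒≢ s<t (suc-injective (*-cancelʳ-≡ _ _ m eq)))

∈-multiples⇒≥ : ∀ {m l e} → e ∈ multiples m l → m ≤ e
∈-multiples⇒≥ {m} e∈ with ∈-applyUpTo⁻ _ e∈
... | t , _ , refl = m≤m+n m (t * m)

∈-multiples⇒≤ : ∀ {m l e} → e ∈ multiples m l → e ≤ l * m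
∈-multiples⇒≤ {m} e∈ with ∈-applyUpTo⁻ _ e∈
... | _ , t<l , refl = *-monoˡ-≤ m t<l

∣-∣*-∈-multiples : ∀ m {l a b} → a < suc l → b < suc l → a ≢ b → ∣ a - b ∣ * m ∈ multiples m l
∣-∣*-∈-multiples m {l} {a} {b} a<1+l b<1+l a≢b with ∣ a - b ∣ in gap
... | zero  = ⊥-elim (a≢b (∣m-n∣≡0⇒m≡n gap))
... | suc t = ∈-applyUpTo⁺ _ (s≤s⁻¹ (≤-<-trans (≤-trans (≤-reflexive (sym gap)) (∣m-n∣≤m⊔n a b))
                                              (⊔-pres-<m a<1+l b<1+l)))

module SquareConstruction (l : ℕ) where

  k : ℕ
  k = suc l

  point : ℕ → ℕ × ℕ
  point x = x , x % k * (k * k)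

  grid : Fin (k * k) → ℕ × ℕ
  grid = point ∘ toℕ

  grid-distinctX : DistinctX (embed ∘ grid)
  grid-distinctX i j i≢j ιi≡ιj = i≢j (toℕ-injective (ι-injective ιi≡ιj))

  ℓ∞-point-≡% : ∀ x y → x % k ≡ y % k → ℓ∞ (point x) (point y) ≡ ∣ x / k - y / k ∣ * k
  ℓ∞-point-≡% x y r≡ = begin
    ∣ x - y ∣ ⊔ ∣ x % k * (k * k) - y % k * (k * k) ∣
      ≡⟨ cong (λ r → ∣ x - y ∣ ⊔ ∣ x % k * (k * k) - r * (k * k) ∣) (sym r≡) ⟩
    ∣ x - y ∣ ⊔ ∣ x % k * (k * k) - x % k * (k * k) ∣
      ≡⟨ cong (∣ x - y ∣ ⊔_) (∣n-n∣≡0 (x % k * (k * k))) ⟩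
    ∣ x - y ∣ ⊔ 0
      ≡⟨ ⊔-identityʳ ∣ x - y ∣ ⟩
    ∣ x - y ∣
      ≡⟨ cong₂ ∣_-_∣ (m≡m%n+[m/n]*n x k) (trans (m≡m%n+[m/n]*n y k) (cong (_+ y / k * k) (sym r≡))) ⟩
    ∣ x % k + x / k * k - x % k + y / k * k ∣
      ≡⟨ ∣m+n-m+o∣≡∣n-o∣ (x % k) (x / k * k) (y / k * k) ⟩
    ∣ x / k * k - y / k * k ∣
      ≡⟨ *-distribʳ-∣-∣ k (x / k) (y / k) ⟨
    ∣ x / k - y / k ∣ * k
      ∎
    where open ≡-Reasoning

  ℓ∞-point-≢% : ∀ {x y} → x < k * k → y < k * k → x % k ≢ y % k →
                ℓ∞ (point x) (point y) ≡ ∣ x % k - y % k ∣ * (k * k)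
  ℓ∞-point-≢% {x} {y} x<k² y<k² r≢ = trans (m≤n⇒m⊔n≡n horizontal≤vertical)
                                          (sym (*-distribʳ-∣-∣ (k * k) (x % k) (y % k)))
    where
      open ≤-Reasoning
      instance
        gap≢0 : NonZero ∣ x % k - y % k ∣
        gap≢0 = ≢-nonZero (r≢ ∘ ∣m-n∣≡0⇒m≡n)
      horizontal≤vertical : ∣ x - y ∣ ≤ ∣ x % k * (k * k) - y % k * (k * k) ∣
      horizontal≤vertical = begin
        ∣ x - y ∣                                  ≤⟨ ∣m-n∣≤m⊔n x y ⟩
        x ⊔ y                                      ≤⟨ <⇒≤ (⊔-pres-<m x<k² y<k²) ⟩
        k * k                                      ≤⟨ m≤n*m (k * k) ∣ x % k - y % k ∣ ⟩
        ∣ x % k - y % k ∣ * (k * k)                ≡⟨ *-distribʳ-∣-∣ (k * k) (x % k) (y % k) ⟩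
        ∣ x % k * (k * k) - y % k * (k * k) ∣      ∎

  distances : List ℕ
  distances = multiples k l ++ multiples (k * k) l

  distances-unique : Unique distances
  distances-unique = Unique.++⁺ (multiples-unique k l) (multiples-unique (k * k) l)
    λ (e∈₁ , e∈₂) → <⇒≱ (≤-<-trans (∈-multiples⇒≤ e∈₁) (*-monoˡ-< k (n<1+n l)))
                         (∈-multiples⇒≥ e∈₂)

  length-distances : length distances ≡ 2 * k ∸ 2
  length-distances = begin
    length (multiples k l ++ multiples (k * k) l)
      ≡⟨ length-++ (multiples k l) ⟩
    length (multiples k l) + length (multiples (k * k) l)
      ≡⟨ cong₂ _+_ (length-applyUpTo _ l) (length-applyUpTo _ l) ⟩
    l + l
      ≡⟨ cong (_+_ l) (+-identityʳ l) ⟨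
    2 * l
      ≡⟨ *-distribˡ-∸ 2 k 1 ⟩
    2 * k ∸ 2
      ∎
    where open ≡-Reasoning

  spans⇒∈distances : ∀ d → SpansDistance grid d → d ∈ distances
  spans⇒∈distances _ (i , j , i≢j , refl) with toℕ i % k ≟ toℕ j % k
  ... | yes r≡ = subst (_∈ distances) (sym (ℓ∞-point-≡% (toℕ i) (toℕ j) r≡))
        (∈-++⁺ˡ (∣-∣*-∈-multiples k (quotient< i) (quotient< j)
                  (i≢j ∘ toℕ-injective ∘ %-/-injective r≡)))
    where
      quotient< : (i : Fin (k * k)) → toℕ i / k < k
      quotient< i = m<n*o⇒m/o<n (toℕ<n i)
  ... | no r≢ = subst (_∈ distances) (sym (ℓ∞-point-≢% (toℕ<n i) (toℕ<n j) r≢))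
        (∈-++⁺ʳ (multiples k l) (∣-∣*-∈-multiples (k * k) (m%n<n (toℕ i) k) (m%n<n (toℕ j) k) r≢))

  spans-from-0 : ∀ {y} → 0 < y → y < k * k → SpansDistance grid (ℓ∞ (point 0) (point y))
  spans-from-0 0<y y<k² = zero , fromℕ< y<k² ,
    (λ 0≡j → <⇒≢ 0<y (trans (cong toℕ 0≡j) (toℕ-fromℕ< y<k²))) ,
    cong (ℓ∞ (point 0) ∘ point) (toℕ-fromℕ< y<k²)

  ∈distances⇒spans : ∀ d → d ∈ distances → SpansDistance grid d
  ∈distances⇒spans d d∈ with ∈-++⁻ (multiples k l) d∈
  ... | inj₁ d∈₁ with ∈-applyUpTo⁻ _ d∈₁
  ...   | t , t<l , refl = subst (SpansDistance grid) same-residue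
          (spans-from-0 (s≤s z≤n) (*-monoˡ-< k (s≤s t<l)))
    where
      same-residue : ℓ∞ (point 0) (point (suc t * k)) ≡ suc t * k
      same-residue = trans (ℓ∞-point-≡% 0 (suc t * k) (sym (m*n%n≡0 (suc t) k)))
                           (cong (_* k) (m*n/n≡m (suc t) k))
  ∈distances⇒spans d d∈ | inj₂ d∈₂ with ∈-applyUpTo⁻ _ d∈₂
  ...   | t , t<l , refl = subst (SpansDistance grid) other-residue (spans-from-0 (s≤s z≤n) 1+t<k²)
    where
      1+t<k² : suc t < k * k
      1+t<k² = <-≤-trans (s≤s t<l) (m≤m*n k k)
      1+t%k≡1+t : suc t % k ≡ suc t
      1+t%k≡1+t = m<n⇒m%n≡m (s≤s t<l)
      other-residue : ℓ∞ (point 0) (point (suc t)) ≡ suc t * (k * k)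
      other-residue = trans (ℓ∞-point-≢% (s≤s z≤n) 1+t<k² (λ 0≡ → 0≢1+n (trans 0≡ 1+t%k≡1+t)))
                            (cong (_* (k * k)) 1+t%k≡1+t)

theorem1p4 : (n k : ℕ) → 0 < n → n ≡ k * k →
    Σ[ P ∈ (Fin n → Point) ] (DistinctX P × NumDistances P (2 * k ∸ 2))
theorem1p4 _ zero    ()  refl
theorem1p4 _ (suc l) _   refl =
  embed ∘ grid , grid-distinctX ,
  subst (NumDistances (embed ∘ grid)) length-distances
    (numDistances-embed grid distances distances-unique
      (λ d → mk⇔ (∈distances⇒spans d) (spans⇒∈distances d)))
  where open SquareConstruction l
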